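{- Let $G$ be a simple graph containing a $10$-cycle $u_0,u_1,\dots,u_9$, and let $c: V(G)\to\{0,1,\dots,9\}$ be a coloring of the nodes. Let $B$ be the set of free neighbors $s$ of $u_0$ that have at least $10$ pairwise node-disjoint $3$-paths to $u_3$. Then $|B| \leq 1$.
   Context: A node $s$ is free if it does not participate in any $10$-cycle of $G$. For $s \in N(u_0)$, a $3$-path of $s$ (to $u_3$) is a path $w_0,w_1,w_2$ of nodes such that $w_0 \in N(s)$, $w_2\in N(u_3)$, $w_0w_1$ and $w_1w_2$ are edges, $c(w_j)=j$ for $j=0,1,2$, and the path is node-disjoint from $\{u_0,u_1,u_2\}$. Two $3$-paths are node-disjoint if they share no node. $N(v)$ denotes the set of neighbors of $v$. -}

module Defs where

open import Level using (Level; suc)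
open import Data.Nat using (ℕ)
open import Data.Fin using (Fin; zero; suc; fromℕ<)
open import Data.Fin.Patterns
open import Data.Product using (Σ; ∃; _×_; _,_)
open import Relation.Nullary using (¬_)
open import Relation.Binary.PropositionalEquality using (_≡_; _≢_)
open import Function.Definitions using (Injective)

record SimpleGraph (n : ℕ) : Set₁ where
  field
    Adj    : Fin n → Fin n → Set
    sym    : ∀ {x y} → Adj x y → Adj y x
    irrefl : ∀ {x} → ¬ Adj x x

open SimpleGraph public

next10 : Fin 10 → Fin 10
next10 0F = 1F
next10 1F = 2F
next10 2F = 3F
next10 3F = 4F
next10 4F = 5F
next10 5F = 6F
next10 6F = 7F
next10 7F = 8F
next10 8F = 9F
next10 9F = 0F

Is10Cycle : ∀ {n} → SimpleGraph n → (Fin 10 → Fin n) → Set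
Is10Cycle G u = Injective _≡_ _≡_ u × (∀ i → Adj G (u i) (u (next10 i)))

OnSome10Cycle : ∀ {n} → SimpleGraph n → Fin n → Set
OnSome10Cycle {n} G x = Σ (Fin 10 → Fin n) λ v → Is10Cycle G v × ∃ λ i → v i ≡ x

Free : ∀ {n} → SimpleGraph n → Fin n → Set
Free G x = ¬ OnSome10Cycle G x

record ThreePath {n} (G : SimpleGraph n) (c : Fin n → Fin 10)
                 (u : Fin 10 → Fin n) (s : Fin n) : Set where
  field
    w       : Fin 3 → Fin n
    adj-s   : Adj G s (w 0F)
    adj-01  : Adj G (w 0F) (w 1F)
    adj-12  : Adj G (w 1F) (w 2F)
    adj-u3  : Adj G (w 2F) (u 3F)
    col0    : c (w 0F) ≡ 0F
    col1    : c (w 1F) ≡ 1F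
    col2    : c (w 2F) ≡ 2F
    avoid-u : ∀ (j : Fin 3) → (w j ≢ u 0F) × (w j ≢ u 1F) × (w j ≢ u 2F)

open ThreePath public

Disjoint : ∀ {n G c u s t} → ThreePath {n} G c u s → ThreePath {n} G c u t → Set
Disjoint P Q = ∀ (j k : Fin 3) → w P j ≢ w Q k

Has10DisjointPaths : ∀ {n} → SimpleGraph n → (Fin n → Fin 10) → (Fin 10 → Fin n)
                   → Fin n → Set
Has10DisjointPaths G c u s =
  Σ (Fin 10 → ThreePath G c u s) λ P → ∀ i j → i ≢ j → Disjoint (P i) (P j)

InB : ∀ {n} → SimpleGraph n → (Fin n → Fin 10) → (Fin 10 → Fin n) → Fin n → Set
InB G c u s = Adj G (u 0F) s × Free G s × Has10DisjointPaths G c u s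

-- If s ≠ t both lie in B, pick a 3-path p of s avoiding s, t, u₃, u₀, and then a
-- 3-path q of t avoiding these four nodes and p; ten pairwise disjoint paths
-- leave a choice each time. Then s p₀ p₁ p₂ u₃ q₂ q₁ q₀ t u₀ is a 10-cycle
-- through s, contradicting that s is free.
module Submission where

open import Defs renaming (sym to Adj-sym)
open import Data.Nat as ℕ using (ℕ)
open import Data.Nat.Properties using (_<?_)
open import Data.Fin using (Fin; zero; suc; _≟_)
open import Data.Fin.Patterns
open import Data.Fin.Properties using (pigeonhole; ¬∀⟶∃¬; <⇒≢)
open import Data.List using (List; []; _∷_; _++_; length; lookup)
open import Data.List.Relation.Unary.Any using (Any; here; there; index; any?)
open import Data.List.Relation.Unary.Any.Properties using (lookup-index)
open import Data.List.Relation.Unary.All as All using (_∷_; [])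
open import Data.List.Relation.Unary.AllPairs using (_∷_; [])
open import Data.List.Relation.Unary.Unique.Propositional using (Unique)
open import Data.List.Relation.Unary.Unique.Propositional.Properties using (++⁺)
open import Data.List.Relation.Binary.Disjoint.Propositional using ()
  renaming (Disjoint to Disjointᴸ)
open import Data.List.Membership.Propositional using (_∈_; lose)
open import Data.List.Membership.Propositional.Properties using (∈-lookup)
open import Data.Product using (Σ; ∃; _,_; proj₁; proj₂; map₂)
open import Data.Empty using (⊥-elim)
open import Function.Definitions using (Injective)
open import Relation.Nullary using (¬_; yes; no; contradiction)
open import Relation.Nullary.Decidable using (from-yes)
open import Relation.Binary.Definitions using (DecidableEquality)
open import Relation.Binary.PropositionalEquality
  using (_≡_; _≢_; refl; sym; trans; cong; subst)

module _ {A : Set} where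

  lookup-injective : ∀ {xs : List A} → Unique xs → Injective _≡_ _≡_ (lookup xs)
  lookup-injective (_     ∷ _)   {zero}  {zero}  _   = refl
  lookup-injective (x∉xs ∷ _)   {zero}  {suc j} x≡y = contradiction x≡y (All.lookup x∉xs (∈-lookup j))
  lookup-injective (x∉xs ∷ _)   {suc i} {zero}  y≡x = contradiction (sym y≡x) (All.lookup x∉xs (∈-lookup i))
  lookup-injective (_     ∷ xs!) {suc i} {suc j} eq  = cong suc (lookup-injective xs! eq)

module _ {A : Set} (_≟ᴬ_ : DecidableEquality A) where

  open import Data.List.Membership.DecPropositional _≟ᴬ_ using (_∈?_)

  -- Pigeonhole: if each of m pairwise disjoint lists met L, two of them would meet
  -- L at the same position.
  some-disjoint-from : ∀ {m} (xss : Fin m → List A)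
                     → (∀ i j → i ≢ j → Disjointᴸ (xss i) (xss j))
                     → (L : List A) → length L ℕ.< m
                     → ∃ λ i → Disjointᴸ (xss i) L
  some-disjoint-from {m} xss pairwise L |L|<m =
    map₂ (λ ¬meets (x∈xs , x∈L) → ¬meets (lose x∈L x∈xs))
         (¬∀⟶∃¬ m Meets (λ i → any? (_∈? xss i) L) ¬all-meet)
    where
    Meets : Fin m → Set
    Meets i = Any (_∈ xss i) L

    ¬all-meet : ¬ (∀ i → Meets i)
    ¬all-meet meets with i , k , i<k , same ← pigeonhole |L|<m (λ i → index (meets i)) =
      pairwise i k (<⇒≢ i<k)
        (lookup-index (meets i) , subst (λ p → lookup L p ∈ xss k) (sym same) (lookup-index (meets k)))

free-avoids-cycle : ∀ {n} (G : SimpleGraph n) {u : Fin 10 → Fin n} → Is10Cycle G u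
                  → ∀ {x} → Free G x → ∀ i → x ≢ u i
free-avoids-cycle G {u} cyc free i x≡uᵢ = free (u , cyc , i , sym x≡uᵢ)

module _ {n} {G : SimpleGraph n} {c : Fin n → Fin 10} {u : Fin 10 → Fin n} where

  nodes : ∀ {s} → ThreePath G c u s → List (Fin n)
  nodes P = w P 0F ∷ w P 1F ∷ w P 2F ∷ []

  ∈-nodes : ∀ {s x} (P : ThreePath G c u s) → x ∈ nodes P → ∃ λ j → x ≡ w P j
  ∈-nodes _ (here x≡w₀)                 = 0F , x≡w₀
  ∈-nodes _ (there (here x≡w₁))         = 1F , x≡w₁
  ∈-nodes _ (there (there (here x≡w₂))) = 2F , x≡w₂

  Disjoint⇒Disjointᴸ : ∀ {s t} (P : ThreePath G c u s) (Q : ThreePath G c u t)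
                     → Disjoint P Q → Disjointᴸ (nodes P) (nodes Q)
  Disjoint⇒Disjointᴸ P Q P#Q (x∈P , x∈Q)
    with j , refl ← ∈-nodes P x∈P | k , x≡wₖ ← ∈-nodes Q x∈Q =
    P#Q j k x≡wₖ

  differently-coloured : ∀ {x y} {i j : Fin 10} → c x ≡ i → c y ≡ j → i ≢ j → x ≢ y
  differently-coloured cx≡i cy≡j i≢j refl = i≢j (trans (sym cx≡i) cy≡j)

  nodes-unique : ∀ {s} (P : ThreePath G c u s) → Unique (nodes P)
  nodes-unique P =
    (differently-coloured (col0 P) (col1 P) (λ ()) ∷ differently-coloured (col0 P) (col2 P) (λ ()) ∷ [])
    ∷ (differently-coloured (col1 P) (col2 P) (λ ()) ∷ [])
    ∷ []
    ∷ []

  avoiding-path : ∀ {s} → Has10DisjointPaths G c u s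
                → (L : List (Fin n)) → length L ℕ.< 10
                → Σ (ThreePath G c u s) λ P → Disjointᴸ (nodes P) L
  avoiding-path (P , pairwise) L |L|<10
    with i , Pᵢ#L ← some-disjoint-from _≟_ (λ i → nodes (P i))
                      (λ i j i≢j → Disjoint⇒Disjointᴸ (P i) (P j) (pairwise i j i≢j)) L |L|<10 =
    P i , Pᵢ#L

module _ {n} {G : SimpleGraph n} {c : Fin n → Fin 10} {u : Fin 10 → Fin n} {s t : Fin n}
         (p : ThreePath G c u s) (q : ThreePath G c u t) where

  layout : List (Fin n)
  layout = nodes q ++ nodes p ++ s ∷ t ∷ u 3F ∷ u 0F ∷ []

  -- The cycle s p₀ p₁ p₂ u₃ q₂ q₁ q₀ t u₀, as positions in layout.
  visit : Fin 10 → Fin 10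
  visit 0F = 6F
  visit 1F = 3F
  visit 2F = 4F
  visit 3F = 5F
  visit 4F = 8F
  visit 5F = 2F
  visit 6F = 1F
  visit 7F = 0F
  visit 8F = 7F
  visit 9F = 9F

  unvisit : Fin 10 → Fin 10
  unvisit 0F = 7F
  unvisit 1F = 6F
  unvisit 2F = 5F
  unvisit 3F = 1F
  unvisit 4F = 2F
  unvisit 5F = 3F
  unvisit 6F = 0F
  unvisit 7F = 8F
  unvisit 8F = 4F
  unvisit 9F = 9F

  unvisit-visit : ∀ i → unvisit (visit i) ≡ i
  unvisit-visit 0F = refl
  unvisit-visit 1F = refl
  unvisit-visit 2F = refl
  unvisit-visit 3F = refl
  unvisit-visit 4F = refl
  unvisit-visit 5F = refl
  unvisit-visit 6F = refl
  unvisit-visit 7F = refl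
  unvisit-visit 8F = refl
  unvisit-visit 9F = refl

  visit-injective : Injective _≡_ _≡_ visit
  visit-injective {i} {j} eq = trans (sym (unvisit-visit i)) (trans (cong unvisit eq) (unvisit-visit j))

  glued : Fin 10 → Fin n
  glued i = lookup layout (visit i)

  glued-is-10-cycle : Adj G (u 0F) s → Adj G (u 0F) t → Unique layout → Is10Cycle G glued
  glued-is-10-cycle u₀s u₀t layout! = (λ eq → visit-injective (lookup-injective layout! eq)) , adjacent
    where
    adjacent : ∀ i → Adj G (glued i) (glued (next10 i))
    adjacent 0F = adj-s p
    adjacent 1F = adj-01 p
    adjacent 2F = adj-12 p
    adjacent 3F = adj-u3 p
    adjacent 4F = Adj-sym G (adj-u3 q)
    adjacent 5F = Adj-sym G (adj-12 q)
    adjacent 6F = Adj-sym G (adj-01 q)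
    adjacent 7F = Adj-sym G (adj-s q)
    adjacent 8F = Adj-sym G u₀t
    adjacent 9F = u₀s

frame-unique : ∀ {n} (G : SimpleGraph n) {u : Fin 10 → Fin n} → Is10Cycle G u
             → ∀ {s t} → Free G s → Free G t → s ≢ t
             → Unique (s ∷ t ∷ u 3F ∷ u 0F ∷ [])
frame-unique G {u} cyc {s} {t} free-s free-t s≢t =
  (s≢t ∷ s∉u 3F ∷ s∉u 0F ∷ []) ∷ (t∉u 3F ∷ t∉u 0F ∷ []) ∷ (u₃≢u₀ ∷ []) ∷ [] ∷ []
  where
  s∉u : ∀ i → s ≢ u i
  s∉u = free-avoids-cycle G cyc free-s

  t∉u : ∀ i → t ≢ u i
  t∉u = free-avoids-cycle G cyc free-t

  u₃≢u₀ : u 3F ≢ u 0F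
  u₃≢u₀ eq with () ← proj₁ cyc eq

lemma26 : ∀ (n : ℕ) (G : SimpleGraph n) (u : Fin 10 → Fin n) (c : Fin n → Fin 10)
          → Is10Cycle G u
          → ∀ (s t : Fin n) → InB G c u s → InB G c u t → s ≡ t
lemma26 n G u c cyc s t (u₀s , free-s , paths-s) (u₀t , free-t , paths-t) with s ≟ t
... | yes s≡t = s≡t
... | no s≢t = ⊥-elim (free-s (glued p q , glued-is-10-cycle p q u₀s u₀t layout! , 0F , refl))
  where
  frame : List (Fin n)
  frame = s ∷ t ∷ u 3F ∷ u 0F ∷ []

  p-avoiding : Σ (ThreePath G c u s) λ P → Disjointᴸ (nodes P) frame
  p-avoiding = avoiding-path paths-s frame (from-yes (4 <? 10))

  p : ThreePath G c u s
  p = proj₁ p-avoiding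

  q-avoiding : Σ (ThreePath G c u t) λ Q → Disjointᴸ (nodes Q) (nodes p ++ frame)
  q-avoiding = avoiding-path paths-t (nodes p ++ frame) (from-yes (7 <? 10))

  q : ThreePath G c u t
  q = proj₁ q-avoiding

  layout! : Unique (layout p q)
  layout! = ++⁺ (nodes-unique q)
                (++⁺ (nodes-unique p) (frame-unique G cyc free-s free-t s≢t) (proj₂ p-avoiding))
                (proj₂ q-avoiding)
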